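{- The equation $t_z = \frac{x^4 + y^4}{2}$ has infinitely many non-trivial solutions in integers $x, y, z$, where a solution is called trivial if it is of the form $x = m$, $y = m^2$, $z = m^4$ for some $m \in \mathbb{N}$. In other words, there are infinitely many three-term arithmetic progressions consisting of the numbers $x^4, t_z, y^4$ not arising from such trivial solutions.
   Context: $t_n = \frac{n(n+1)}{2}$ denotes the $n$-th triangular number. -}

module Defs where

open import Data.Nat using (ℕ; zero; suc; _+_; _*_; _^_)
open import Data.Product using (∃; _×_)
open import Relation.Binary.PropositionalEquality using (_≡_)

-- n-th triangular number t_n = n(n+1)/2, defined by t_0 = 0, t_{n+1} = (n+1) + t_n
t : ℕ → ℕ
t zero = 0
t (suc n) = suc n + t n

IsSolution : ℕ → ℕ → ℕ → Set
IsSolution x y z = 2 * t z ≡ x ^ 4 + y ^ 4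

IsTrivial : ℕ → ℕ → ℕ → Set
IsTrivial x y z = ∃ λ m → x ≡ m × y ≡ m ^ 2 × z ≡ m ^ 4

module Submission where

-- For every u, with x = 5u + 4 and z = 65u² + 116u + 52, one has
-- the polynomial identity  z² + z = x⁴ + (60u² + 109u + 50)².  Since 2·t_z = z² + z,
-- (x, y, z) solves  2·t_z = x⁴ + y⁴  as soon as  y² = 60u² + 109u + 50,  i.e. as
-- soon as (u, y) lies on this conic.  The conic carries an automorphism
--   (u, y) ↦ (1921u + 248y + 1744, 14880u + 1921y + 13516)
-- of Pell type, and (71, 557) lies on it, so iterating the automorphism produces
-- infinitely many conic points with u growing at least linearly, hence solutions
-- with z arbitrarily large.  Such solutions are never trivial: a trivial (x, y, z)
-- forces z = x⁴ and a trivial (y, x, z) forces z = x², whereas x² < z < x⁴ here.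

open import Defs
open import Data.Nat using (ℕ; zero; suc; _+_; _*_; _^_; _<_; _≤_; z≤n; s≤s)
open import Data.Nat.Properties
  using ( m<m+n; +-cancelʳ-≡; +-suc; *-identityʳ; ^-distribˡ-+-*; <⇒≢; ≤-refl
        ; <-≤-trans; <-trans; +-monoʳ-≤; module ≤-Reasoning)
open import Data.Nat.GeneralisedArithmetic using (iterate)
open import Data.Nat.Tactic.RingSolver using (solve-∀)
open import Data.Product using (∃; _×_; _,_; proj₁; proj₂)
open import Relation.Nullary using (¬_)
open import Relation.Binary.PropositionalEquality
  using (_≡_; refl; sym; cong; cong₂; subst; module ≡-Reasoning)

<-by-excess : ∀ a c {b} → a + suc c ≡ b → a < b
<-by-excess a c refl = m<m+n a (s≤s z≤n)

twice-triangular : ∀ z → 2 * t z ≡ z * z + z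
twice-triangular zero    = refl
twice-triangular (suc z) = begin
  2 * (suc z + t z)        ≡⟨ double-sum z (t z) ⟩
  2 + 2 * z + 2 * t z      ≡⟨ cong (2 + 2 * z +_) (twice-triangular z) ⟩
  2 + 2 * z + (z * z + z)  ≡⟨ square-succ z ⟩
  suc z * suc z + suc z    ∎
  where
  open ≡-Reasoning
  double-sum : ∀ z s → 2 * (suc z + s) ≡ 2 + 2 * z + 2 * s
  double-sum = solve-∀
  square-succ : ∀ z → 2 + 2 * z + (z * z + z) ≡ suc z * suc z + suc z
  square-succ = solve-∀

iterate-preserves : ∀ {A : Set} (P : A → Set) (f : A → A) →
  (∀ a → P a → P (f a)) → ∀ a → P a → ∀ n → P (iterate f a n)
iterate-preserves P f pres a pa zero    = pa
iterate-preserves P f pres a pa (suc n) = iterate-preserves P f pres (f a) (pres a pa) n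

iterate-grows : ∀ {A : Set} (μ : A → ℕ) (f : A → A) →
  (∀ a → suc (μ a) ≤ μ (f a)) → ∀ a n → n + μ a ≤ μ (iterate f a n)
iterate-grows μ f inc a zero    = ≤-refl
iterate-grows μ f inc a (suc n) = begin
  suc n + μ a       ≡⟨ sym (+-suc n (μ a)) ⟩
  n + suc (μ a)     ≤⟨ +-monoʳ-≤ n (inc a) ⟩
  n + μ (f a)       ≤⟨ iterate-grows μ f inc (f a) n ⟩
  μ (iterate f (f a) n) ∎
  where open ≤-Reasoning

-- Fourth powers as products, the form the ring solver handles.
fourth-power : ∀ m → m ^ 4 ≡ (m * m) * (m * m)
fourth-power m = begin
  m ^ 4           ≡⟨ ^-distribˡ-+-* m 2 2 ⟩
  m ^ 2 * m ^ 2   ≡⟨ cong (λ s → s * s) (cong (m *_) (*-identityʳ m)) ⟩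
  m * m * (m * m) ∎
  where open ≡-Reasoning

nontrivial-below-x⁴ : ∀ {x y z} → z < x ^ 4 → ¬ IsTrivial x y z
nontrivial-below-x⁴ z<x⁴ (m , refl , _ , refl) = <⇒≢ z<x⁴ refl

nontrivial-swapped-above-x² : ∀ {x y z} → x * x < z → ¬ IsTrivial y x z
nontrivial-swapped-above-x² x²<z (m , _ , refl , refl) =
  <⇒≢ x²<z (sym (^-distribˡ-+-* m 2 2))

conic : ℕ → ℕ
conic u = 60 * (u * u) + 109 * u + 50

OnConic : ℕ × ℕ → Set
OnConic (u , y) = y * y ≡ conic u

-- A Pell-type automorphism of the conic, and its defining identity
-- y'² - conic u' = y² - conic u, written without subtraction (the polynomials
-- are spelled out, as the ring solver does not unfold definitions).
automorphism : ℕ × ℕ → ℕ × ℕ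
automorphism (u , y) = 1921 * u + 248 * y + 1744 , 14880 * u + 1921 * y + 13516

automorphism-identity : ∀ u y →
  (14880 * u + 1921 * y + 13516) * (14880 * u + 1921 * y + 13516)
    + (60 * (u * u) + 109 * u + 50)
  ≡ 60 * ((1921 * u + 248 * y + 1744) * (1921 * u + 248 * y + 1744))
    + 109 * (1921 * u + 248 * y + 1744) + 50 + y * y
automorphism-identity = solve-∀

automorphism-preserves-conic : ∀ p → OnConic p → OnConic (automorphism p)
automorphism-preserves-conic (u , y) y²≡conic =
  +-cancelʳ-≡ (conic u) _ _ (begin
    y' * y' + conic u   ≡⟨ automorphism-identity u y ⟩
    conic u' + y * y    ≡⟨ cong (conic u' +_) y²≡conic ⟩
    conic u' + conic u  ∎)
  where
  open ≡-Reasoning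
  u' = proj₁ (automorphism (u , y))
  y' = proj₂ (automorphism (u , y))

automorphism-increases : ∀ p → suc (proj₁ p) ≤ proj₁ (automorphism p)
automorphism-increases (u , y) = <-by-excess u (1920 * u + 248 * y + 1743) (excess u y)
  where
  excess : ∀ u y → u + suc (1920 * u + 248 * y + 1743) ≡ 1921 * u + 248 * y + 1744
  excess = solve-∀

-- The orbit of the seed point (71, 557), which lies on the conic since
-- 557² = 310249 = 60·71² + 109·71 + 50; its u-coordinates exceed their index.
seed : ℕ × ℕ
seed = 71 , 557

conic-point : ℕ → ℕ × ℕ
conic-point = iterate automorphism seed

conic-point-on-conic : ∀ n → OnConic (conic-point n)
conic-point-on-conic =
  iterate-preserves OnConic automorphism automorphism-preserves-conic seed refl

conic-point-grows : ∀ n → n < proj₁ (conic-point n)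
conic-point-grows n = <-≤-trans (m<m+n n (s≤s z≤n))
  (iterate-grows proj₁ automorphism automorphism-increases seed n)

-- The parametric family x = 5u + 4, z = 65u² + 116u + 52 and its key identity
-- z² + z = x⁴ + conic(u)², again with the definitions spelled out for the solver.
family-x family-z : ℕ → ℕ
family-x u = 5 * u + 4
family-z u = 65 * (u * u) + 116 * u + 52

family-identity : ∀ u →
  (65 * (u * u) + 116 * u + 52) * (65 * (u * u) + 116 * u + 52) + (65 * (u * u) + 116 * u + 52)
  ≡ (5 * u + 4) * (5 * u + 4) * ((5 * u + 4) * (5 * u + 4))
    + (60 * (u * u) + 109 * u + 50) * (60 * (u * u) + 109 * u + 50)
family-identity = solve-∀

family-solution : ∀ u y → OnConic (u , y) → IsSolution (family-x u) y (family-z u)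
family-solution u y y²≡conic = begin
  2 * t z                             ≡⟨ twice-triangular z ⟩
  z * z + z                           ≡⟨ family-identity u ⟩
  x * x * (x * x) + conic u * conic u ≡⟨ cong (λ c → x * x * (x * x) + c * c) (sym y²≡conic) ⟩
  x * x * (x * x) + y * y * (y * y)   ≡⟨ sym (cong₂ _+_ (fourth-power x) (fourth-power y)) ⟩
  x ^ 4 + y ^ 4                       ∎
  where
  open ≡-Reasoning
  x = family-x u
  z = family-z u

family-z-above-u : ∀ u → u < family-z u
family-z-above-u u = <-by-excess u (65 * (u * u) + 115 * u + 51) (excess u)
  where
  excess : ∀ u → u + suc (65 * (u * u) + 115 * u + 51) ≡ 65 * (u * u) + 116 * u + 52
  excess = solve-∀

family-z-above-x² : ∀ u → family-x u * family-x u < family-z u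
family-z-above-x² u = <-by-excess (family-x u * family-x u) (40 * (u * u) + 76 * u + 35) (excess u)
  where
  excess : ∀ u → (5 * u + 4) * (5 * u + 4) + suc (40 * (u * u) + 76 * u + 35)
                   ≡ 65 * (u * u) + 116 * u + 52
  excess = solve-∀

family-z-below-x⁴ : ∀ u → family-z u < family-x u ^ 4
family-z-below-x⁴ u = subst (family-z u <_) (sym (fourth-power (family-x u)))
  (<-by-excess (family-z u) c (excess u))
  where
  c : ℕ
  c = 625 * (u * u * u * u) + 2000 * (u * u * u) + 2335 * (u * u) + 1164 * u + 203
  excess : ∀ u → 65 * (u * u) + 116 * u + 52
                   + suc (625 * (u * u * u * u) + 2000 * (u * u * u) + 2335 * (u * u) + 1164 * u + 203)
                   ≡ (5 * u + 4) * (5 * u + 4) * ((5 * u + 4) * (5 * u + 4))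
  excess = solve-∀

theorem4p3 : (N : ℕ) → ∃ λ x → ∃ λ y → ∃ λ z →
    N < z × IsSolution x y z × ¬ IsTrivial x y z × ¬ IsTrivial y x z
theorem4p3 N =
    family-x u , y , family-z u
  , <-trans (conic-point-grows N) (family-z-above-u u)
  , family-solution u y (conic-point-on-conic N)
  , nontrivial-below-x⁴ (family-z-below-x⁴ u)
  , nontrivial-swapped-above-x² (family-z-above-x² u)
  where
  u = proj₁ (conic-point N)
  y = proj₂ (conic-point N)
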